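{- Let $G=(X,E)$ be a symmetric 2-structure, $\mathcal{I}$ an involution of its colours without fixed point, and let $U,V$ be two crossing involution modules of $G$. Then $U\cap V$ is an involution module of $G$.
   Context: A (symmetric) 2-structure is a pair $G=(X,E)$ with $X$ finite and $E:X^2\to\mathbb{N}$ symmetric; its colour set is $C=\{E(u,v):u\neq v\}$. For $s\in X$, $i\in C$, $X'\subseteq X$, $N^i_s(X')=\{x\in X':E(s,x)=i\}$. Given an involution $\mathcal{I}$ of $C$ without fixed point, $U\subseteq X$ is an involution module if for all $u,v\in U$, either $N^i_u(X\setminus U)=N^{\mathcal{I}(i)}_v(X\setminus U)$ for all $i\in C$, or $N^i_u(X\setminus U)=N^{i}_v(X\setminus U)$ for all $i\in C$. Two sets $A,B\subseteq X$ are crossing if $A\cap B$, $A\setminus B$, $B\setminus A$ are all nonempty and $A\cup B\neq X$. -}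

module Defs where

open import Data.Nat using (ℕ)
open import Data.Fin using (Fin)
open import Data.Fin.Subset using (Subset; _∈_; _∉_; _∩_; _∪_; ⊤; Nonempty; _─_)
open import Data.Product using (_×_; ∃; ∃-syntax; _,_)
open import Data.Sum using (_⊎_)
open import Function.Bundles using (_⇔_)
open import Relation.Binary.PropositionalEquality using (_≡_; _≢_)
open import Relation.Nullary using (¬_)

record TwoStructure (n : ℕ) : Set where
  field
    E   : Fin n → Fin n → ℕ
    sym : ∀ u v → E u v ≡ E v u
open TwoStructure public

InColours : ∀ {n} → TwoStructure n → ℕ → Set
InColours G i = ∃[ u ] ∃[ v ] (u ≢ v × TwoStructure.E G u v ≡ i)

record FPFInvolution {n} (G : TwoStructure n) : Set where
  field
    I        : ℕ → ℕ
    closed   : ∀ i → InColours G i → InColours G (I i)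
    involut  : ∀ i → InColours G i → I (I i) ≡ i
    nofix    : ∀ i → InColours G i → I i ≢ i
open FPFInvolution public

-- x ∈ N^i_s(X \ U)  iff  x ∉ U and E(s,x) = i.
-- Equality of neighbourhoods N^i_u(X∖U) = N^j_v(X∖U), as sets:
SameNbhd : ∀ {n} → TwoStructure n → Subset n → Fin n → ℕ → Fin n → ℕ → Set
SameNbhd G U u i v j =
  ∀ x → x ∉ U → (TwoStructure.E G u x ≡ i ⇔ TwoStructure.E G v x ≡ j)

IsInvolutionModule : ∀ {n} (G : TwoStructure n) → FPFInvolution G → Subset n → Set
IsInvolutionModule G 𝓘 U =
  ∀ u v → u ∈ U → v ∈ U →
    (∀ i → InColours G i → SameNbhd G U u i v (FPFInvolution.I 𝓘 i))
    ⊎ (∀ i → InColours G i → SameNbhd G U u i v i)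

Crossing : ∀ {n} → Subset n → Subset n → Set
Crossing A B =
  Nonempty (A ∩ B) × Nonempty (A ─ B) × Nonempty (B ─ A) × ¬ (A ∪ B ≡ ⊤)

-- For u, v ∈ U write "u relates to v on U via j" when N^i_u(X∖U) equals
-- N^{j(i)}_v(X∖U) for every colour i; U is an involution module iff every
-- pair of its vertices is related either via 𝓘 ("twisted") or via the
-- identity ("aligned").  The proof needs only one part of crossing:
-- U ∪ V ≠ X, i.e. some vertex x lies outside both U and V.
--   * Relations on U and on V via the same j combine to a relation on U ∩ V,
--     since every vertex outside U ∩ V is outside U or outside V.
--   * A vertex x outside both modules pins the colour E(v,x): a pair u, v
--     related via j on U and via k on V has j(c) = E(v,x) = k(c) for the
--     colour c = E(u,x).  So u, v cannot be twisted on one module and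
--     aligned on the other, as 𝓘 has no fixed point.
-- Hence for u, v ∈ U ∩ V both modules give the same kind of relation, and
-- it transfers to U ∩ V.
module Submission where

open import Defs
open import Data.Nat using (ℕ)
open import Data.Fin using (Fin)
open import Data.Fin.Properties using (¬∀⟶∃¬)
open import Data.Fin.Subset using (Subset; _∩_; _∪_; _∈_; _∉_; ⊤)
open import Data.Fin.Subset.Properties
  using (_∈?_; x∈p∩q⁺; x∈p∩q⁻; x∈p∪q⁺; ⊆-antisym; ⊆⊤)
open import Data.Product using (_×_; _,_; ∃-syntax)
open import Data.Sum using (_⊎_; inj₁; inj₂)
open import Data.Empty using (⊥; ⊥-elim)
open import Function.Bundles using (Equivalence)
open import Relation.Binary.PropositionalEquality
  using (_≡_; refl; trans; subst) renaming (sym to ≡-sym)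
open import Relation.Nullary using (¬_; yes; no)

common-outsider : ∀ {n} {A B : Subset n} → ¬ (A ∪ B ≡ ⊤) → ∃[ x ] (x ∉ A × x ∉ B)
common-outsider {n} {A} {B} A∪B≢⊤ = outsider (¬∀⟶∃¬ n (_∈ A ∪ B) (_∈? A ∪ B) not-everywhere)
  where
  not-everywhere : ¬ (∀ x → x ∈ A ∪ B)
  not-everywhere all∈ = A∪B≢⊤ (⊆-antisym ⊆⊤ (λ {x} _ → all∈ x))

  outsider : ∃[ x ] (x ∉ A ∪ B) → ∃[ x ] (x ∉ A × x ∉ B)
  outsider (x , x∉A∪B) =
    x , (λ x∈A → x∉A∪B (x∈p∪q⁺ (inj₁ x∈A))) , (λ x∈B → x∉A∪B (x∈p∪q⁺ (inj₂ x∈B)))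

∉∩⇒∉⊎∉ : ∀ {n} (A B : Subset n) x → x ∉ A ∩ B → x ∉ A ⊎ x ∉ B
∉∩⇒∉⊎∉ A B x x∉A∩B with x ∈? A | x ∈? B
... | yes x∈A | yes x∈B = ⊥-elim (x∉A∩B (x∈p∩q⁺ (x∈A , x∈B)))
... | no  x∉A | _       = inj₁ x∉A
... | yes _   | no  x∉B = inj₂ x∉B

colour-across : ∀ {n} (G : TwoStructure n) {A : Subset n} {u x} →
  u ∈ A → x ∉ A → InColours G (E G u x)
colour-across G {A} {u} {x} u∈A x∉A =
  u , x , (λ u≡x → x∉A (subst (_∈ A) u≡x u∈A)) , refl

Relates : ∀ {n} → TwoStructure n → Subset n → Fin n → Fin n → (ℕ → ℕ) → Set
Relates G A u v j = ∀ i → InColours G i → SameNbhd G A u i v (j i)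

relates-∩ : ∀ {n} {G : TwoStructure n} {A B : Subset n} {u v} {j : ℕ → ℕ} →
  Relates G A u v j → Relates G B u v j → Relates G (A ∩ B) u v j
relates-∩ {A = A} {B} relA relB i i∈C x x∉A∩B with ∉∩⇒∉⊎∉ A B x x∉A∩B
... | inj₁ x∉A = relA i i∈C x x∉A
... | inj₂ x∉B = relB i i∈C x x∉B

-- A vertex x outside A and B forces j and k to agree on the colour
-- c = E(u,x): both j(c) and k(c) equal E(v,x).
relates-agree : ∀ {n} {G : TwoStructure n} {A B : Subset n} {u v x} {j k : ℕ → ℕ} →
  InColours G (E G u x) → x ∉ A → x ∉ B →
  Relates G A u v j → Relates G B u v k → j (E G u x) ≡ k (E G u x)
relates-agree {G = G} {u = u} {x = x} c∈C x∉A x∉B relA relB =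
  trans (≡-sym (Equivalence.to (relA (E G u x) c∈C x x∉A) refl))
        (Equivalence.to (relB (E G u x) c∈C x x∉B) refl)

twisted-aligned-clash : ∀ {n} {G : TwoStructure n} (𝓘 : FPFInvolution G)
  {A B : Subset n} {u v x} → u ∈ A → x ∉ A → x ∉ B →
  Relates G A u v (I 𝓘) → Relates G B u v (λ i → i) → ⊥
twisted-aligned-clash {G = G} 𝓘 {u = u} {x = x} u∈A x∉A x∉B twisted aligned =
  nofix 𝓘 (E G u x) c∈C (relates-agree {G = G} c∈C x∉A x∉B twisted aligned)
  where
  c∈C : InColours G (E G u x)
  c∈C = colour-across G u∈A x∉A

mainTheorem3 : ∀ {n} (G : TwoStructure n) (𝓘 : FPFInvolution G) (U V : Subset n) →
    IsInvolutionModule G 𝓘 U → IsInvolutionModule G 𝓘 V → Crossing U V →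
    IsInvolutionModule G 𝓘 (U ∩ V)
mainTheorem3 G 𝓘 U V modU modV (_ , _ , _ , U∪V≢X) u v u∈U∩V v∈U∩V
  with x , x∉U , x∉V ← common-outsider U∪V≢X
     | u∈U , u∈V ← x∈p∩q⁻ U V u∈U∩V
     | v∈U , v∈V ← x∈p∩q⁻ U V v∈U∩V
  with modU u v u∈U v∈U | modV u v u∈V v∈V
... | inj₁ twistedU | inj₁ twistedV = inj₁ (relates-∩ {G = G} twistedU twistedV)
... | inj₂ alignedU | inj₂ alignedV = inj₂ (relates-∩ {G = G} alignedU alignedV)
... | inj₁ twistedU | inj₂ alignedV = ⊥-elim (twisted-aligned-clash 𝓘 u∈U x∉U x∉V twistedU alignedV)
... | inj₂ alignedU | inj₁ twistedV = ⊥-elim (twisted-aligned-clash 𝓘 u∈V x∉V x∉U twistedV alignedU)
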